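{- Let $a,b,c$ be positive integers such that $Q^{abc}=1+x^a(x+1)^b(1+x+x^2)^c$ is irreducible over $\mathbb{F}_2$, and suppose $(Q^{abc})^*=1+x^d(x+1)^e$ for some positive integers $d,e$. If $a$ is odd and $b$ is even, then $a=e=1$, $b=c=2^m$ and $d=3\cdot 2^m$ for some integer $m\ge 1$.
   Context: Here $Q=1+x+x^2$ and $P^*(x):=x^{\deg P}P(1/x)$ is the reciprocal of $P\in\mathbb{F}_2[x]$; thus $(Q^{abc})^*=x^{a+b+2c}+(x+1)^b(x^2+x+1)^c$. -}

module Defs where

open import Data.Bool using (Bool; true; false; _xor_; _∧_; not)
open import Data.List using (List; []; _∷_; reverse; length; replicate)
open import Data.Nat using (ℕ; zero; suc; _∸_)
open import Data.Product using (_×_)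
open import Data.Sum using (_⊎_)
open import Relation.Binary.PropositionalEquality using (_≡_)
open import Relation.Nullary using (¬_)

-- Polynomials over 𝔽₂ as coefficient lists, lowest degree first
-- (true = 1, false = 0).  Trailing zeros are allowed; equality of
-- polynomials is equality of normal forms (trailing zeros stripped).
Poly : Set
Poly = List Bool

norm : Poly → Poly
norm [] = []
norm (c ∷ p) with norm p
... | [] = if c then true ∷ [] else []
  where
    if_then_else_ : Bool → Poly → Poly → Poly
    if true then x else y = x
    if false then x else y = y
... | q@(_ ∷ _) = c ∷ q

_≈ₚ_ : Poly → Poly → Set
p ≈ₚ q = norm p ≡ norm q

infix 4 _≈ₚ_

_+ₚ_ : Poly → Poly → Poly
[] +ₚ q = q
(c ∷ p) +ₚ [] = c ∷ p
(c ∷ p) +ₚ (d ∷ q) = (c xor d) ∷ (p +ₚ q)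

infixl 6 _+ₚ_

scale : Bool → Poly → Poly
scale false p = []
scale true p = p

_*ₚ_ : Poly → Poly → Poly
[] *ₚ q = []
(c ∷ p) *ₚ q = scale c q +ₚ (false ∷ (p *ₚ q))

infixl 7 _*ₚ_

oneₚ : Poly
oneₚ = true ∷ []

xₚ : Poly
xₚ = false ∷ true ∷ []

_^ₚ_ : Poly → ℕ → Poly
p ^ₚ zero = oneₚ
p ^ₚ suc n = p *ₚ (p ^ₚ n)

infixr 8 _^ₚ_

-- degree (degree of the zero polynomial is taken to be 0; irrelevant here)
deg : Poly → ℕ
deg p = length (norm p) ∸ 1

-- reciprocal P*(x) = x^{deg P} P(1/x): reverse the normalised coefficient list
reciprocal : Poly → Poly
reciprocal p = reverse (norm p)

-- units of 𝔽₂[x]: the nonzero constants, i.e. 1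
IsUnit : Poly → Set
IsUnit p = p ≈ₚ oneₚ

Irreducible : Poly → Set
Irreducible p =
  ¬ (p ≈ₚ []) × ¬ IsUnit p ×
  ((f g : Poly) → f *ₚ g ≈ₚ p → IsUnit f ⊎ IsUnit g)

Qₚ : Poly
Qₚ = true ∷ true ∷ true ∷ []

x+1 : Poly
x+1 = true ∷ true ∷ []

Qabc : ℕ → ℕ → ℕ → Poly
Qabc a b c = oneₚ +ₚ (xₚ ^ₚ a) *ₚ (x+1 ^ₚ b) *ₚ (Qₚ ^ₚ c)

-- Reading the reciprocal identity backwards (Q^{abc} has constant term 1
-- and (x+1)^e is a palindrome) gives Q^{abc} = (x+1)^e + x^M with
-- M = a + b + 2c = e + d.  Everything else compares valuations (exact
-- powers of x dividing a polynomial), driven by one 2-adic fact: for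
-- P = 1 + x + ⋯, the valuation of 1 + P^n is the 2-part 2^k of n.
--   at 0:  1 + (x+1)^e = G + x^M with v(G) = a forces a = 2^k, so a = 1;
--   at 1 (substituting x ↦ x+1): M is odd and b ≥ 2, which forces e = 1;
--   cancelling x leaves (x+1)^b Q^c = 1 + x^{b+2c}; at 1 this gives b = 2^m,
--   c = 2^m·s with m ≥ 1; taking 2^m-th roots (the Frobenius is injective)
--   leaves (x+1) Q^s = 1 + x^{2s+1}, and then s = 1 since 3 is no power of 2.
-- The file develops 𝔽₂[x] up to coefficientwise equality (ring laws, the
-- Frobenius, the substitution x ↦ x+1), then valuations, degrees and
-- reciprocals, and finally the steps above.

module Submission where

open import Defs
open import Data.Nat using (ℕ; _*_; _^_; _≤_)
open import Data.Nat.Divisibility using (_∣_)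
open import Data.Product using (_×_; ∃-syntax)
open import Relation.Binary.PropositionalEquality using (_≡_)
open import Relation.Nullary using (¬_)

open import Level using (0ℓ)
open import Data.Bool using (Bool; true; false; _xor_; _∧_)
open import Data.Bool.Properties
  using (xor-comm; xor-assoc; xor-identityʳ; xor-same; ∧-identityʳ; ∧-zeroʳ)
open import Data.Empty using (⊥-elim)
open import Data.List using ([]; _∷_; _++_; reverse; length; replicate)
import Data.List.Properties as List
open import Data.Nat using (zero; suc; _+_; _<_; z≤n; s≤s)
import Data.Nat.Properties as ℕ
open import Data.Nat.Divisibility using (divides; ∣1⇒≡1)
open import Data.Nat.Induction using (<-rec)
open import Data.Nat.Tactic.RingSolver using (solve-∀)
open import Data.Product using (Σ; _,_)
open import Data.Sum using (_⊎_; inj₁; inj₂)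
open import Algebra.Bundles using (CommutativeSemigroup)
import Algebra.Properties.CommutativeSemigroup as CommSemigroupProperties
open import Relation.Binary.Bundles using (Setoid)
open import Relation.Binary.Definitions using (tri<; tri≈; tri>)
open import Relation.Binary.PropositionalEquality using (refl; sym; trans; cong; cong₂; subst; subst₂)

-- Coefficientwise equality.  The coefficient functional ignores trailing
-- zeros, so _≋_ coincides with the equality _≈ₚ_ but is far easier
-- to reason with.

coeff : Poly → ℕ → Bool
coeff []      i       = false
coeff (c ∷ p) zero    = c
coeff (c ∷ p) (suc i) = coeff p i

infix 4 _≋_
record _≋_ (p q : Poly) : Set where
  constructor pw
  field at : ∀ i → coeff p i ≡ coeff q i
open _≋_

≋-refl : ∀ {p} → p ≋ p
≋-refl = pw λ i → refl

≋-sym : ∀ {p q} → p ≋ q → q ≋ p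
≋-sym h = pw λ i → sym (at h i)

≋-trans : ∀ {p q r} → p ≋ q → q ≋ r → p ≋ r
≋-trans h g = pw λ i → trans (at h i) (at g i)

≋-setoid : Setoid 0ℓ 0ℓ
≋-setoid = record
  { Carrier = Poly ; _≈_ = _≋_
  ; isEquivalence = record { refl = ≋-refl ; sym = ≋-sym ; trans = ≋-trans } }

open import Relation.Binary.Reasoning.Setoid ≋-setoid

∷-cong : ∀ {c d p q} → c ≡ d → p ≋ q → c ∷ p ≋ d ∷ q
∷-cong c≡d h = pw λ { zero → c≡d ; (suc i) → at h i }

tail-≋ : ∀ {c d p q} → c ∷ p ≋ d ∷ q → p ≋ q
tail-≋ h = pw λ i → at h (suc i)

shift : Poly → Poly
shift p = false ∷ p

shiftBy : ℕ → Poly → Poly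
shiftBy n p = replicate n false ++ p

shift[]≋[] : shift [] ≋ []
shift[]≋[] = pw λ { zero → refl ; (suc i) → refl }

∷≋[]⇒≋[] : ∀ {c p} → c ∷ p ≋ [] → p ≋ []
∷≋[]⇒≋[] h = tail-≋ (≋-trans h (≋-sym shift[]≋[]))

step : Bool → Poly → Poly
step c     (x ∷ q) = c ∷ x ∷ q
step true  []      = true ∷ []
step false []      = []

norm-∷ : ∀ c p → norm (c ∷ p) ≡ step c (norm p)
norm-∷ c p with norm p
norm-∷ true  p | []    = refl
norm-∷ false p | []    = refl
...            | x ∷ q = refl

coeff-step : ∀ c p i → coeff (step c p) i ≡ coeff (c ∷ p) i
coeff-step c     (x ∷ p) i       = refl
coeff-step true  []      zero    = refl
coeff-step true  []      (suc i) = refl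
coeff-step false []      zero    = refl
coeff-step false []      (suc i) = refl

norm-≋ : ∀ p → norm p ≋ p
norm-≋ []      = ≋-refl
norm-≋ (c ∷ p) = pw λ i → trans (cong (λ r → coeff r i) (norm-∷ c p))
                      (trans (coeff-step c (norm p) i) (at (∷-cong refl (norm-≋ p)) i))

≈ₚ⇒≋ : ∀ {p q} → p ≈ₚ q → p ≋ q
≈ₚ⇒≋ {p} {q} h = begin p ≈⟨ norm-≋ p ⟨ norm p ≡⟨ h ⟩ norm q ≈⟨ norm-≋ q ⟩ q ∎

≋[]⇒norm≡[] : ∀ p → p ≋ [] → norm p ≡ []
≋[]⇒norm≡[] []      h = refl
≋[]⇒norm≡[] (c ∷ p) h =
  trans (norm-∷ c p) (cong₂ step (at h 0) (≋[]⇒norm≡[] p (∷≋[]⇒≋[] h)))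

≋⇒≈ₚ : ∀ p q → p ≋ q → p ≈ₚ q
≋⇒≈ₚ []      q       h = sym (≋[]⇒norm≡[] q (≋-sym h))
≋⇒≈ₚ (c ∷ p) []      h = ≋[]⇒norm≡[] (c ∷ p) h
≋⇒≈ₚ (c ∷ p) (d ∷ q) h =
  trans (norm-∷ c p) (trans (cong₂ step (at h 0) (≋⇒≈ₚ p q (tail-≋ h))) (sym (norm-∷ d q)))

coeff-+ : ∀ p q i → coeff (p +ₚ q) i ≡ coeff p i xor coeff q i
coeff-+ []      q       i       = refl
coeff-+ (c ∷ p) []      zero    = sym (xor-identityʳ c)
coeff-+ (c ∷ p) []      (suc i) = sym (xor-identityʳ (coeff p i))
coeff-+ (c ∷ p) (d ∷ q) zero    = refl
coeff-+ (c ∷ p) (d ∷ q) (suc i) = coeff-+ p q i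

+-cong : ∀ {p p′ q q′} → p ≋ p′ → q ≋ q′ → p +ₚ q ≋ p′ +ₚ q′
+-cong {p} {p′} {q} {q′} h g = pw λ i →
  trans (coeff-+ p q i) (trans (cong₂ _xor_ (at h i) (at g i)) (sym (coeff-+ p′ q′ i)))

+-comm : ∀ p q → p +ₚ q ≋ q +ₚ p
+-comm p q = pw λ i →
  trans (coeff-+ p q i) (trans (xor-comm (coeff p i) (coeff q i)) (sym (coeff-+ q p i)))

+-assoc : ∀ p q r → (p +ₚ q) +ₚ r ≋ p +ₚ (q +ₚ r)
+-assoc p q r = pw λ i →
  trans (coeff-+ (p +ₚ q) r i) (trans (cong (_xor coeff r i) (coeff-+ p q i))
  (trans (xor-assoc (coeff p i) (coeff q i) (coeff r i))
  (trans (cong (coeff p i xor_) (sym (coeff-+ q r i))) (sym (coeff-+ p (q +ₚ r) i)))))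

+-identityʳ : ∀ p → p +ₚ [] ≋ p
+-identityʳ []      = ≋-refl
+-identityʳ (c ∷ p) = ≋-refl

+-self : ∀ p → p +ₚ p ≋ []
+-self p = pw λ i → trans (coeff-+ p p i) (xor-same (coeff p i))

+-commutativeSemigroup : CommutativeSemigroup 0ℓ 0ℓ
+-commutativeSemigroup = record
  { Carrier = Poly ; _≈_ = _≋_ ; _∙_ = _+ₚ_
  ; isCommutativeSemigroup = record
    { isSemigroup = record
      { isMagma = record { isEquivalence = Setoid.isEquivalence ≋-setoid ; ∙-cong = +-cong }
      ; assoc = +-assoc }
    ; comm = +-comm } }

open CommSemigroupProperties +-commutativeSemigroup using ()
  renaming (interchange to +-interchange; xy∙z≈xz∙y to +-xy∙z≈xz∙y)

≡⇒≋ : ∀ {p q} → p ≡ q → p ≋ q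
≡⇒≋ refl = ≋-refl

shift-cong : ∀ {p q} → p ≋ q → shift p ≋ shift q
shift-cong = ∷-cong refl

coeff-scale : ∀ c p i → coeff (scale c p) i ≡ c ∧ coeff p i
coeff-scale false p i = refl
coeff-scale true  p i = refl

scale-xor : ∀ c d r → scale (c xor d) r ≋ scale c r +ₚ scale d r
scale-xor true  true  r = ≋-sym (+-self r)
scale-xor true  false r = ≋-sym (+-identityʳ r)
scale-xor false d     r = ≋-refl

coeff-* : ∀ c p q i → coeff ((c ∷ p) *ₚ q) i ≡ (c ∧ coeff q i) xor coeff (shift (p *ₚ q)) i
coeff-* c p q i =
  trans (coeff-+ (scale c q) (shift (p *ₚ q)) i) (cong (_xor coeff (shift (p *ₚ q)) i) (coeff-scale c q i))

*-zeroˡ : ∀ z q → z ≋ [] → z *ₚ q ≋ []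
*-zeroˡ []      q h = ≋-refl
*-zeroˡ (c ∷ z) q h = begin
  scale c q +ₚ shift (z *ₚ q)  ≈⟨ +-cong (scale-false (at h 0)) (shift-cong (*-zeroˡ z q (∷≋[]⇒≋[] h))) ⟩
  shift []                     ≈⟨ shift[]≋[] ⟩
  []                           ∎
  where
  scale-false : c ≡ false → scale c q ≋ []
  scale-false refl = ≋-refl

scale-[] : ∀ c → scale c [] ≋ []
scale-[] false = ≋-refl
scale-[] true  = ≋-refl

*-zeroʳ : ∀ p → p *ₚ [] ≋ []
*-zeroʳ []      = ≋-refl
*-zeroʳ (c ∷ p) = ≋-trans (+-cong (scale-[] c) (shift-cong (*-zeroʳ p))) shift[]≋[]

*-congˡ : ∀ {p p′} q → p ≋ p′ → p *ₚ q ≋ p′ *ₚ q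
*-congˡ {[]}    {p′}     q h = ≋-sym (*-zeroˡ p′ q (≋-sym h))
*-congˡ {c ∷ p} {[]}     q h = *-zeroˡ (c ∷ p) q h
*-congˡ {c ∷ p} {c′ ∷ p′} q h =
  +-cong (≡⇒≋ (cong (λ d → scale d q) (at h 0))) (shift-cong (*-congˡ q (tail-≋ h)))

*-congʳ : ∀ p {q q′} → q ≋ q′ → p *ₚ q ≋ p *ₚ q′
*-congʳ []      h = ≋-refl
*-congʳ (c ∷ p) h = +-cong (scale-cong c h) (shift-cong (*-congʳ p h))
  where
  scale-cong : ∀ c {q q′} → q ≋ q′ → scale c q ≋ scale c q′
  scale-cong false h = ≋-refl
  scale-cong true  h = h

*-cong : ∀ {p p′ q q′} → p ≋ p′ → q ≋ q′ → p *ₚ q ≋ p′ *ₚ q′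
*-cong {p′ = p′} {q} h g = ≋-trans (*-congˡ q h) (*-congʳ p′ g)

*-identityˡ : ∀ q → oneₚ *ₚ q ≋ q
*-identityˡ q = ≋-trans (+-cong (≋-refl {q}) shift[]≋[]) (+-identityʳ q)

x*≋shift : ∀ q → xₚ *ₚ q ≋ shift q
x*≋shift q = shift-cong (*-identityˡ q)

distribʳ : ∀ p q r → (p +ₚ q) *ₚ r ≋ (p *ₚ r) +ₚ (q *ₚ r)
distribʳ []      q       r = ≋-refl
distribʳ (c ∷ p) []      r = ≋-sym (+-identityʳ _)
distribʳ (c ∷ p) (d ∷ q) r = begin
  scale (c xor d) r +ₚ shift ((p +ₚ q) *ₚ r)
    ≈⟨ +-cong (scale-xor c d r) (shift-cong (distribʳ p q r)) ⟩
  (scale c r +ₚ scale d r) +ₚ (shift (p *ₚ r) +ₚ shift (q *ₚ r))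
    ≈⟨ +-interchange (scale c r) (scale d r) (shift (p *ₚ r)) (shift (q *ₚ r)) ⟩
  (scale c r +ₚ shift (p *ₚ r)) +ₚ (scale d r +ₚ shift (q *ₚ r))
    ∎

*-assoc : ∀ p q r → (p *ₚ q) *ₚ r ≋ p *ₚ (q *ₚ r)
*-assoc []      q r = ≋-refl
*-assoc (c ∷ p) q r = begin
  (scale c q +ₚ shift (p *ₚ q)) *ₚ r      ≈⟨ distribʳ (scale c q) (shift (p *ₚ q)) r ⟩
  scale c q *ₚ r +ₚ shift ((p *ₚ q) *ₚ r)  ≈⟨ +-cong (scale-* c) (shift-cong (*-assoc p q r)) ⟩
  scale c (q *ₚ r) +ₚ shift (p *ₚ (q *ₚ r)) ∎
  where
  scale-* : ∀ c → scale c q *ₚ r ≋ scale c (q *ₚ r)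
  scale-* false = ≋-refl
  scale-* true  = ≋-refl

distribˡ : ∀ p q r → p *ₚ (q +ₚ r) ≋ (p *ₚ q) +ₚ (p *ₚ r)
distribˡ []      q r = ≋-refl
distribˡ (c ∷ p) q r = begin
  scale c (q +ₚ r) +ₚ shift (p *ₚ (q +ₚ r))
    ≈⟨ +-cong (scale-+ c) (shift-cong (distribˡ p q r)) ⟩
  (scale c q +ₚ scale c r) +ₚ (shift (p *ₚ q) +ₚ shift (p *ₚ r))
    ≈⟨ +-interchange (scale c q) (scale c r) (shift (p *ₚ q)) (shift (p *ₚ r)) ⟩
  (scale c q +ₚ shift (p *ₚ q)) +ₚ (scale c r +ₚ shift (p *ₚ r))
    ∎
  where
  scale-+ : ∀ c → scale c (q +ₚ r) ≋ scale c q +ₚ scale c r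
  scale-+ false = ≋-refl
  scale-+ true  = ≋-refl

*-shiftʳ : ∀ p q → p *ₚ shift q ≋ shift (p *ₚ q)
*-shiftʳ []      q = ≋-sym shift[]≋[]
*-shiftʳ (c ∷ p) q = +-cong (scale-shift c) (shift-cong (*-shiftʳ p q))
  where
  scale-shift : ∀ c → scale c (shift q) ≋ shift (scale c q)
  scale-shift false = ≋-sym shift[]≋[]
  scale-shift true  = ≋-refl

*-constʳ : ∀ p c → p *ₚ (c ∷ []) ≋ scale c p
*-constʳ []      c = ≋-sym (scale-[] c)
*-constʳ (d ∷ p) c = ≋-trans (+-cong ≋-refl (shift-cong (*-constʳ p c))) (cons-scale c d)
  where
  cons-scale : ∀ c d → scale d (c ∷ []) +ₚ shift (scale c p) ≋ scale c (d ∷ p)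
  cons-scale false false = shift[]≋[]
  cons-scale false true  = shift[]≋[]
  cons-scale true  false = ≋-refl
  cons-scale true  true  = ≋-refl

*-comm : ∀ p q → p *ₚ q ≋ q *ₚ p
*-comm []      q = ≋-sym (*-zeroʳ q)
*-comm (c ∷ p) q = begin
  scale c q +ₚ shift (p *ₚ q)           ≈⟨ +-cong (*-constʳ q c) (shift-cong (≋-sym (*-comm p q))) ⟨
  q *ₚ (c ∷ []) +ₚ shift (q *ₚ p)       ≈⟨ +-cong ≋-refl (*-shiftʳ q p) ⟨
  q *ₚ (c ∷ []) +ₚ q *ₚ shift p         ≈⟨ distribˡ q (c ∷ []) (shift p) ⟨
  q *ₚ ((c ∷ []) +ₚ shift p)            ≈⟨ *-congʳ q (∷-cong (xor-identityʳ c) ≋-refl) ⟩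
  q *ₚ (c ∷ p)                          ∎

*-identityʳ : ∀ q → q *ₚ oneₚ ≋ q
*-identityʳ q = ≋-trans (*-comm q oneₚ) (*-identityˡ q)

*-commutativeSemigroup : CommutativeSemigroup 0ℓ 0ℓ
*-commutativeSemigroup = record
  { Carrier = Poly ; _≈_ = _≋_ ; _∙_ = _*ₚ_
  ; isCommutativeSemigroup = record
    { isSemigroup = record
      { isMagma = record { isEquivalence = Setoid.isEquivalence ≋-setoid ; ∙-cong = *-cong }
      ; assoc = *-assoc }
    ; comm = *-comm } }

open CommSemigroupProperties *-commutativeSemigroup using () renaming (interchange to *-interchange)

+-move : ∀ {p q r} → p +ₚ q ≋ r → q ≋ p +ₚ r
+-move {p} {q} {r} h = begin
  q                 ≈⟨ +-cong (+-self p) (≋-refl {q}) ⟨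
  (p +ₚ p) +ₚ q     ≈⟨ +-assoc p p q ⟩
  p +ₚ (p +ₚ q)     ≈⟨ +-cong ≋-refl h ⟩
  p +ₚ r            ∎

+-cancel-middle : ∀ p q r → (p +ₚ q) +ₚ (q +ₚ r) ≋ p +ₚ r
+-cancel-middle p q r = begin
  (p +ₚ q) +ₚ (q +ₚ r)  ≈⟨ +-assoc p q (q +ₚ r) ⟩
  p +ₚ (q +ₚ (q +ₚ r))  ≈⟨ +-cong (≋-refl {p}) (+-assoc q q r) ⟨
  p +ₚ ((q +ₚ q) +ₚ r)  ≈⟨ +-cong (≋-refl {p}) (+-cong (+-self q) (≋-refl {r})) ⟩
  p +ₚ r                ∎

+-swap : ∀ p q r s → p +ₚ q ≋ r +ₚ s → p +ₚ r ≋ q +ₚ s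
+-swap p q r s h = begin
  p +ₚ r                ≈⟨ +-cancel-middle p q r ⟨
  (p +ₚ q) +ₚ (q +ₚ r)  ≈⟨ +-cong h (+-comm q r) ⟩
  (r +ₚ s) +ₚ (r +ₚ q)  ≈⟨ +-cong (+-comm r s) ≋-refl ⟩
  (s +ₚ r) +ₚ (r +ₚ q)  ≈⟨ +-cancel-middle s r q ⟩
  s +ₚ q                ≈⟨ +-comm s q ⟩
  q +ₚ s                ∎

+-isolate : ∀ p q r s → p +ₚ q ≋ r +ₚ s → r ≋ (p +ₚ s) +ₚ q
+-isolate p q r s h = begin
  r                  ≈⟨ +-identityʳ r ⟨
  r +ₚ []            ≈⟨ +-cong (≋-refl {r}) (+-self s) ⟨
  r +ₚ (s +ₚ s)      ≈⟨ +-assoc r s s ⟨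
  (r +ₚ s) +ₚ s      ≈⟨ +-cong h (≋-refl {s}) ⟨
  (p +ₚ q) +ₚ s      ≈⟨ +-xy∙z≈xz∙y p q s ⟩
  (p +ₚ s) +ₚ q      ∎

^-cong : ∀ {p q} n → p ≋ q → p ^ₚ n ≋ q ^ₚ n
^-cong zero    h = ≋-refl
^-cong (suc n) h = *-cong h (^-cong n h)

^-+ : ∀ p m n → p ^ₚ (m + n) ≋ (p ^ₚ m) *ₚ (p ^ₚ n)
^-+ p zero    n = ≋-sym (*-identityˡ _)
^-+ p (suc m) n = ≋-trans (*-congʳ p (^-+ p m n)) (≋-sym (*-assoc p (p ^ₚ m) (p ^ₚ n)))

xⁿ*≋shiftBy : ∀ n q → (xₚ ^ₚ n) *ₚ q ≋ shiftBy n q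
xⁿ*≋shiftBy zero    q = *-identityˡ q
xⁿ*≋shiftBy (suc n) q = begin
  (xₚ *ₚ xₚ ^ₚ n) *ₚ q  ≈⟨ *-assoc xₚ (xₚ ^ₚ n) q ⟩
  xₚ *ₚ (xₚ ^ₚ n *ₚ q)  ≈⟨ x*≋shift _ ⟩
  shift (xₚ ^ₚ n *ₚ q)  ≈⟨ shift-cong (xⁿ*≋shiftBy n q) ⟩
  shiftBy (suc n) q     ∎

xⁿ≋shiftBy : ∀ n → xₚ ^ₚ n ≋ shiftBy n oneₚ
xⁿ≋shiftBy n = ≋-trans (≋-sym (*-identityʳ _)) (xⁿ*≋shiftBy n oneₚ)

-- Valuations.  Val p n says p = x^n·U with U(0) = 1, i.e. p is nonzero and
-- x^n is the exact power of x dividing it.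

Val : Poly → ℕ → Set
Val p n = Σ Poly λ U → (coeff U 0 ≡ true) × (p ≋ shiftBy n U)

coeff-*0 : ∀ p q → coeff (p *ₚ q) 0 ≡ coeff p 0 ∧ coeff q 0
coeff-*0 []      q = refl
coeff-*0 (c ∷ p) q = trans (coeff-* c p q 0) (xor-identityʳ _)

const-* : ∀ p q → coeff p 0 ≡ true → coeff q 0 ≡ true → coeff (p *ₚ q) 0 ≡ true
const-* p q h g = trans (coeff-*0 p q) (cong₂ _∧_ h g)

const-^ : ∀ p n → coeff p 0 ≡ true → coeff (p ^ₚ n) 0 ≡ true
const-^ p zero    h = refl
const-^ p (suc n) h = const-* p (p ^ₚ n) h (const-^ p n h)

coeff-shiftBy< : ∀ n U i → i < n → coeff (shiftBy n U) i ≡ false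
coeff-shiftBy< (suc n) U zero    h       = refl
coeff-shiftBy< (suc n) U (suc i) (s≤s h) = coeff-shiftBy< n U i h

shiftBy-cong : ∀ n {p q} → p ≋ q → shiftBy n p ≋ shiftBy n q
shiftBy-cong zero    h = h
shiftBy-cong (suc n) h = shift-cong (shiftBy-cong n h)

shiftBy-+ : ∀ i j W → shiftBy i (shiftBy j W) ≡ shiftBy (i + j) W
shiftBy-+ zero    j W = refl
shiftBy-+ (suc i) j W = cong shift (shiftBy-+ i j W)

shiftBy-* : ∀ i U q → shiftBy i U *ₚ q ≋ shiftBy i (U *ₚ q)
shiftBy-* zero    U q = ≋-refl
shiftBy-* (suc i) U q = shift-cong (shiftBy-* i U q)

Val-cong : ∀ {p q n} → p ≋ q → Val p n → Val q n
Val-cong h (U , u , g) = U , u , ≋-trans (≋-sym h) g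

Val-unique : ∀ {p i j} → Val p i → Val p j → i ≡ j
Val-unique {i = i} {j} (U , u , h) (V , v , g) = shiftBy-unique i j (≋-trans (≋-sym h) g)
  where
  shiftBy-unique : ∀ i j → shiftBy i U ≋ shiftBy j V → i ≡ j
  shiftBy-unique zero    zero    h = refl
  shiftBy-unique zero    (suc j) h with () ← trans (sym u) (at h 0)
  shiftBy-unique (suc i) zero    h with () ← trans (at h 0) v
  shiftBy-unique (suc i) (suc j) h = cong suc (shiftBy-unique i j (tail-≋ h))

coeff-shiftBy-top : ∀ i U → coeff (shiftBy i U) i ≡ coeff U 0
coeff-shiftBy-top zero    U = refl
coeff-shiftBy-top (suc i) U = coeff-shiftBy-top i U

Val⇒≉[] : ∀ {p i} → Val p i → ¬ (p ≋ [])
Val⇒≉[] {i = i} (U , u , h) z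
  with () ← trans (sym u) (trans (sym (coeff-shiftBy-top i U)) (trans (sym (at h i)) (at z i)))

Val-* : ∀ {p q i j} → Val p i → Val q j → Val (p *ₚ q) (i + j)
Val-* {p} {q} {i} {j} (U , u , h) (V , v , g) = U *ₚ V , const-* U V u v , (begin
  p *ₚ q                             ≈⟨ *-cong h g ⟩
  shiftBy i U *ₚ shiftBy j V         ≈⟨ shiftBy-* i U (shiftBy j V) ⟩
  shiftBy i (U *ₚ shiftBy j V)       ≈⟨ shiftBy-cong i (*-comm U (shiftBy j V)) ⟩
  shiftBy i (shiftBy j V *ₚ U)       ≈⟨ shiftBy-cong i (shiftBy-* j V U) ⟩
  shiftBy i (shiftBy j (V *ₚ U))     ≡⟨ shiftBy-+ i j (V *ₚ U) ⟩
  shiftBy (i + j) (V *ₚ U)           ≈⟨ shiftBy-cong (i + j) (*-comm V U) ⟩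
  shiftBy (i + j) (U *ₚ V)           ∎)

Val-+ : ∀ {p q i j} → Val p i → Val q j → i < j → Val (p +ₚ q) i
Val-+ {p} {q} {i} (U , u , h) (V , v , g) i<j with ℕ.m≤n⇒∃[o]m+o≡n i<j
... | k , refl =
  U +ₚ shiftBy (suc k) V , trans (coeff-+ U (shiftBy (suc k) V) 0) (trans (xor-identityʳ _) u) , (begin
  p +ₚ q                                    ≈⟨ +-cong h g ⟩
  shiftBy i U +ₚ shiftBy (suc i + k) V      ≡⟨ cong (λ n → shiftBy i U +ₚ shiftBy n V) (ℕ.+-suc i k) ⟨
  shiftBy i U +ₚ shiftBy (i + suc k) V      ≡⟨ cong (shiftBy i U +ₚ_) (shiftBy-+ i (suc k) V) ⟨
  shiftBy i U +ₚ shiftBy i (shiftBy (suc k) V) ≈⟨ shiftBy-distrib-+ i ⟩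
  shiftBy i (U +ₚ shiftBy (suc k) V)        ∎)
  where
  shiftBy-distrib-+ : ∀ n {A B} → shiftBy n A +ₚ shiftBy n B ≋ shiftBy n (A +ₚ B)
  shiftBy-distrib-+ zero    = ≋-refl
  shiftBy-distrib-+ (suc n) = shift-cong (shiftBy-distrib-+ n)

Val-unit : ∀ p → coeff p 0 ≡ true → Val p 0
Val-unit p h = p , h , ≋-refl

Val-xⁿ : ∀ n → Val (xₚ ^ₚ n) n
Val-xⁿ n = oneₚ , refl , xⁿ≋shiftBy n

zero-or-Val : ∀ r → (r ≋ []) ⊎ Σ ℕ (Val r)
zero-or-Val []          = inj₁ ≋-refl
zero-or-Val (true ∷ r)  = inj₂ (0 , true ∷ r , refl , ≋-refl)
zero-or-Val (false ∷ r) with zero-or-Val r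
... | inj₁ z               = inj₁ (≋-trans (shift-cong z) shift[]≋[])
... | inj₂ (i , U , u , h) = inj₂ (suc i , U , u , shift-cong h)

-- The Frobenius endomorphism p ↦ p² is an injective ring homomorphism,
-- hence so is its k-th iterate p ↦ p^(2^k).  This lets us extract
-- 2^k-th roots of polynomial identities.

sq : Poly → Poly
sq p = p *ₚ p

sq-cong : ∀ {p q} → p ≋ q → sq p ≋ sq q
sq-cong h = *-cong h h

sq-+ : ∀ p q → sq (p +ₚ q) ≋ sq p +ₚ sq q
sq-+ p q = begin
  (p +ₚ q) *ₚ (p +ₚ q)                              ≈⟨ distribʳ p q (p +ₚ q) ⟩
  p *ₚ (p +ₚ q) +ₚ q *ₚ (p +ₚ q)                    ≈⟨ +-cong (distribˡ p p q) (distribˡ q p q) ⟩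
  (sq p +ₚ p *ₚ q) +ₚ (q *ₚ p +ₚ sq q)
    ≈⟨ +-cong (≋-refl {sq p +ₚ p *ₚ q}) (+-cong (*-comm q p) (≋-refl {sq q})) ⟩
  (sq p +ₚ p *ₚ q) +ₚ (p *ₚ q +ₚ sq q)              ≈⟨ +-cancel-middle (sq p) (p *ₚ q) (sq q) ⟩
  sq p +ₚ sq q                                      ∎

sq-* : ∀ p q → sq (p *ₚ q) ≋ sq p *ₚ sq q
sq-* p q = *-interchange p q p q

-- squaring is injective: (p + q)² = p² + q² vanishes only if p + q does
sq-inj : ∀ p q → sq p ≋ sq q → p ≋ q
sq-inj p q h with zero-or-Val (p +ₚ q)
... | inj₁ p+q≋[]  = ≋-trans (≋-sym (+-identityʳ p)) (≋-sym (+-move p+q≋[]))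
... | inj₂ (i , v) = ⊥-elim (Val⇒≉[] (Val-* v v) (begin
  sq (p +ₚ q)        ≈⟨ sq-+ p q ⟩
  sq p +ₚ sq q       ≈⟨ +-cong h ≋-refl ⟩
  sq q +ₚ sq q       ≈⟨ +-self (sq q) ⟩
  []                 ∎))

2^suc-* : ∀ k n → 2 ^ suc k * n ≡ 2 ^ k * n + 2 ^ k * n
2^suc-* k n = twice (2 ^ k) n
  where
  twice : ∀ m n → 2 * m * n ≡ m * n + m * n
  twice = solve-∀

sqⁿ : ℕ → Poly → Poly
sqⁿ zero    p = p
sqⁿ (suc k) p = sq (sqⁿ k p)

sqⁿ-+ : ∀ k p q → sqⁿ k (p +ₚ q) ≋ sqⁿ k p +ₚ sqⁿ k q
sqⁿ-+ zero    p q = ≋-refl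
sqⁿ-+ (suc k) p q = ≋-trans (sq-cong (sqⁿ-+ k p q)) (sq-+ (sqⁿ k p) (sqⁿ k q))

sqⁿ-* : ∀ k p q → sqⁿ k (p *ₚ q) ≋ sqⁿ k p *ₚ sqⁿ k q
sqⁿ-* zero    p q = ≋-refl
sqⁿ-* (suc k) p q = ≋-trans (sq-cong (sqⁿ-* k p q)) (sq-* (sqⁿ k p) (sqⁿ k q))

sqⁿ-one : ∀ k → sqⁿ k oneₚ ≋ oneₚ
sqⁿ-one zero    = ≋-refl
sqⁿ-one (suc k) = ≋-trans (sq-cong (sqⁿ-one k)) (*-identityˡ oneₚ)

sqⁿ-inj : ∀ k p q → sqⁿ k p ≋ sqⁿ k q → p ≋ q
sqⁿ-inj zero    p q h = h
sqⁿ-inj (suc k) p q h = sqⁿ-inj k p q (sq-inj (sqⁿ k p) (sqⁿ k q) h)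

^-sqⁿ : ∀ p k n → p ^ₚ (2 ^ k * n) ≋ sqⁿ k (p ^ₚ n)
^-sqⁿ p zero    n = ≡⇒≋ (cong (p ^ₚ_) (ℕ.+-identityʳ n))
^-sqⁿ p (suc k) n = begin
  p ^ₚ (2 ^ suc k * n)                    ≡⟨ cong (p ^ₚ_) (2^suc-* k n) ⟩
  p ^ₚ (2 ^ k * n + 2 ^ k * n)            ≈⟨ ^-+ p (2 ^ k * n) (2 ^ k * n) ⟩
  p ^ₚ (2 ^ k * n) *ₚ p ^ₚ (2 ^ k * n)    ≈⟨ sq-cong (^-sqⁿ p k n) ⟩
  sqⁿ (suc k) (p ^ₚ n)                    ∎

frobenius-root : ∀ k P R S n m l →
  P ^ₚ (2 ^ k * n) *ₚ R ^ₚ (2 ^ k * m) ≋ oneₚ +ₚ S ^ₚ (2 ^ k * l) →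
  P ^ₚ n *ₚ R ^ₚ m ≋ oneₚ +ₚ S ^ₚ l
frobenius-root k P R S n m l E = sqⁿ-inj k _ _ (begin
  sqⁿ k (P ^ₚ n *ₚ R ^ₚ m)                   ≈⟨ sqⁿ-* k (P ^ₚ n) (R ^ₚ m) ⟩
  sqⁿ k (P ^ₚ n) *ₚ sqⁿ k (R ^ₚ m)           ≈⟨ *-cong (^-sqⁿ P k n) (^-sqⁿ R k m) ⟨
  P ^ₚ (2 ^ k * n) *ₚ R ^ₚ (2 ^ k * m)       ≈⟨ E ⟩
  oneₚ +ₚ S ^ₚ (2 ^ k * l)                   ≈⟨ +-cong (sqⁿ-one k) (≋-sym (^-sqⁿ S k l)) ⟨
  sqⁿ k oneₚ +ₚ sqⁿ k (S ^ₚ l)               ≈⟨ sqⁿ-+ k oneₚ (S ^ₚ l) ⟨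
  sqⁿ k (oneₚ +ₚ S ^ₚ l)                     ∎)

-- The substitution x ↦ x + 1 is a ring endomorphism exchanging x and
-- x + 1 and fixing Q = 1 + x + x².  It transports information between
-- the behaviour of a polynomial at 0 and at 1.

σ : Poly → Poly
σ []      = []
σ (c ∷ p) = (c ∷ []) +ₚ (x+1 *ₚ σ p)

const-false : ∀ {c} → c ≡ false → c ∷ [] ≋ []
const-false refl = shift[]≋[]

const-*ˡ : ∀ c q → (c ∷ []) *ₚ q ≋ scale c q
const-*ˡ c q = ≋-trans (+-cong (≋-refl {scale c q}) shift[]≋[]) (+-identityʳ (scale c q))

σ-zero : ∀ z → z ≋ [] → σ z ≋ []
σ-zero []      h = ≋-refl
σ-zero (c ∷ z) h =
  +-cong (const-false (at h 0)) (≋-trans (*-congʳ x+1 (σ-zero z (∷≋[]⇒≋[] h))) (*-zeroʳ x+1))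

σ-cong : ∀ {p q} → p ≋ q → σ p ≋ σ q
σ-cong {[]}    {q}     h = ≋-sym (σ-zero q (≋-sym h))
σ-cong {c ∷ p} {[]}    h = σ-zero (c ∷ p) h
σ-cong {c ∷ p} {d ∷ q} h =
  +-cong (≡⇒≋ (cong (_∷ []) (at h 0))) (*-congʳ x+1 (σ-cong (tail-≋ h)))

σ-+ : ∀ p q → σ (p +ₚ q) ≋ σ p +ₚ σ q
σ-+ []      q       = ≋-refl
σ-+ (c ∷ p) []      = ≋-sym (+-identityʳ _)
σ-+ (c ∷ p) (d ∷ q) = begin
  ((c xor d) ∷ []) +ₚ x+1 *ₚ σ (p +ₚ q)
    ≈⟨ +-cong (≋-refl {(c ∷ []) +ₚ (d ∷ [])}) (*-congʳ x+1 (σ-+ p q)) ⟩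
  ((c ∷ []) +ₚ (d ∷ [])) +ₚ x+1 *ₚ (σ p +ₚ σ q)
    ≈⟨ +-cong (≋-refl {(c ∷ []) +ₚ (d ∷ [])}) (distribˡ x+1 (σ p) (σ q)) ⟩
  ((c ∷ []) +ₚ (d ∷ [])) +ₚ (x+1 *ₚ σ p +ₚ x+1 *ₚ σ q)
    ≈⟨ +-interchange (c ∷ []) (d ∷ []) (x+1 *ₚ σ p) (x+1 *ₚ σ q) ⟩
  σ (c ∷ p) +ₚ σ (d ∷ q)
    ∎

σ-* : ∀ p q → σ (p *ₚ q) ≋ σ p *ₚ σ q
σ-* []      q = ≋-refl
σ-* (c ∷ p) q = begin
  σ (scale c q +ₚ shift (p *ₚ q))               ≈⟨ σ-+ (scale c q) (shift (p *ₚ q)) ⟩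
  σ (scale c q) +ₚ σ (shift (p *ₚ q))           ≈⟨ +-cong (σ-scale c) (σ-shift (p *ₚ q)) ⟩
  scale c (σ q) +ₚ x+1 *ₚ σ (p *ₚ q)            ≈⟨ +-cong (≋-refl {scale c (σ q)}) (*-congʳ x+1 (σ-* p q)) ⟩
  scale c (σ q) +ₚ x+1 *ₚ (σ p *ₚ σ q)          ≈⟨ +-cong (const-*ˡ c (σ q)) (*-assoc x+1 (σ p) (σ q)) ⟨
  (c ∷ []) *ₚ σ q +ₚ (x+1 *ₚ σ p) *ₚ σ q        ≈⟨ distribʳ (c ∷ []) (x+1 *ₚ σ p) (σ q) ⟨
  σ (c ∷ p) *ₚ σ q                              ∎
  where
  σ-scale : ∀ c → σ (scale c q) ≋ scale c (σ q)
  σ-scale false = ≋-refl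
  σ-scale true  = ≋-refl
  σ-shift : ∀ r → σ (shift r) ≋ x+1 *ₚ σ r
  σ-shift r = +-cong (const-false refl) ≋-refl

σ-one : σ oneₚ ≋ oneₚ
σ-one = ≈ₚ⇒≋ refl

σ-^ : ∀ p n → σ (p ^ₚ n) ≋ σ p ^ₚ n
σ-^ p zero    = σ-one
σ-^ p (suc n) = ≋-trans (σ-* p (p ^ₚ n)) (*-congʳ (σ p) (σ-^ p n))

σ-xⁿ : ∀ n → σ (xₚ ^ₚ n) ≋ x+1 ^ₚ n
σ-xⁿ n = ≋-trans (σ-^ xₚ n) (^-cong n (≈ₚ⇒≋ refl))

σ-[x+1]ⁿ : ∀ n → σ (x+1 ^ₚ n) ≋ xₚ ^ₚ n
σ-[x+1]ⁿ n = ≋-trans (σ-^ x+1 n) (^-cong n (≈ₚ⇒≋ refl))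

σ-Qⁿ : ∀ n → σ (Qₚ ^ₚ n) ≋ Qₚ ^ₚ n
σ-Qⁿ n = ≋-trans (σ-^ Qₚ n) (^-cong n (≈ₚ⇒≋ refl))

TwoAdic : ℕ → Set
TwoAdic n = Σ ℕ λ k → Σ ℕ λ s → n ≡ 2 ^ k * suc (s + s)

even-or-odd : ∀ n → Σ ℕ λ q → (n ≡ q + q) ⊎ (n ≡ suc (q + q))
even-or-odd zero = 0 , inj₁ refl
even-or-odd (suc n) with even-or-odd n
... | q , inj₁ refl = q , inj₂ refl
... | q , inj₂ refl = suc q , inj₁ (cong suc (sym (ℕ.+-suc q q)))

two-adic : ∀ n → 1 ≤ n → TwoAdic n
two-adic = <-rec (λ n → 1 ≤ n → TwoAdic n) go
  where
  go : ∀ n → (∀ {m} → m < n → 1 ≤ m → TwoAdic m) → 1 ≤ n → TwoAdic n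
  go n rec n≥1 with even-or-odd n
  ... | q     , inj₂ refl = 0 , q , sym (ℕ.*-identityˡ _)
  ... | zero  , inj₁ refl with () ← n≥1
  ... | suc q , inj₁ refl with rec (ℕ.m<m+n (suc q) (s≤s z≤n)) (s≤s z≤n)
  ...   | k , s , eq = suc k , s , trans (cong₂ _+_ eq eq) (sym (2^suc-* k (suc (s + s))))

-- If P = 1 + x + (higher terms) then 1 + P^n has
-- valuation exactly 2^k, the largest power of 2 dividing n: for odd n
-- the coefficient of x in P^n is 1, and squaring doubles valuations.

coeff-*1 : ∀ P R → coeff P 0 ≡ true → coeff R 0 ≡ true →
  coeff (P *ₚ R) 1 ≡ coeff P 1 xor coeff R 1
coeff-*1 []          R () h
coeff-*1 (false ∷ P) R () h
coeff-*1 (true ∷ P)  R refl h =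
  trans (coeff-+ R (shift (P *ₚ R)) 1)
  (trans (cong (coeff R 1 xor_) (trans (coeff-*0 P R) (trans (cong (coeff P 0 ∧_) h) (∧-identityʳ (coeff P 0)))))
  (xor-comm (coeff R 1) (coeff P 0)))

coeff1-odd-power : ∀ P → coeff P 0 ≡ true → coeff P 1 ≡ true →
  ∀ s → coeff (P ^ₚ suc (s + s)) 1 ≡ true
coeff1-odd-power P h0 h1 zero    = trans (at (*-identityʳ P) 1) h1
coeff1-odd-power P h0 h1 (suc s) =
  trans (coeff-*1 P (P ^ₚ (suc s + suc s)) h0 (const-^ P (suc s + suc s) h0))
  (cong₂ _xor_ h1 (trans (cong (λ n → coeff (P ^ₚ n) 1) (ℕ.+-suc (suc s) s))
                  (trans (coeff-*1 P (P ^ₚ suc (s + s)) h0 (const-^ P (suc (s + s)) h0))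
                  (cong₂ _xor_ h1 (coeff1-odd-power P h0 h1 s)))))

Val-1 : ∀ {r} → coeff r 0 ≡ false → coeff r 1 ≡ true → Val r 1
Val-1 {c ∷ r} c≡false r₀≡true = r , r₀≡true , ∷-cong c≡false ≋-refl

Val-1+power : ∀ P → coeff P 0 ≡ true → coeff P 1 ≡ true →
  ∀ n k s → n ≡ 2 ^ k * suc (s + s) → Val (oneₚ +ₚ P ^ₚ n) (2 ^ k)
Val-1+power P h0 h1 n zero s refl = Val-1
  (trans (coeff-+ oneₚ (P ^ₚ n) 0) (cong (true xor_) (const-^ P n h0)))
  (trans (coeff-+ oneₚ (P ^ₚ n) 1)
         (trans (cong (λ m → coeff (P ^ₚ m) 1) (ℕ.+-identityʳ (suc (s + s)))) (coeff1-odd-power P h0 h1 s)))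
Val-1+power P h0 h1 n (suc k) s refl =
  subst (Val (oneₚ +ₚ P ^ₚ n)) (cong (2 ^ k +_) (sym (ℕ.+-identityʳ (2 ^ k))))
    (Val-cong square (Val-* val-half val-half))
  where
  t = 2 ^ k * suc (s + s)
  val-half : Val (oneₚ +ₚ P ^ₚ t) (2 ^ k)
  val-half = Val-1+power P h0 h1 t k s refl
  square : sq (oneₚ +ₚ P ^ₚ t) ≋ oneₚ +ₚ P ^ₚ n
  square = begin
    sq (oneₚ +ₚ P ^ₚ t)        ≈⟨ sq-+ oneₚ (P ^ₚ t) ⟩
    sq oneₚ +ₚ sq (P ^ₚ t)     ≈⟨ +-cong (*-identityˡ oneₚ) (^-+ P t t) ⟨
    oneₚ +ₚ P ^ₚ (t + t)       ≡⟨ cong (λ m → oneₚ +ₚ P ^ₚ m) (2^suc-* k (suc (s + s))) ⟨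
    oneₚ +ₚ P ^ₚ n             ∎

VanishesFrom : Poly → ℕ → Set
VanishesFrom q n = ∀ i → n ≤ i → coeff q i ≡ false

record Deg (p : Poly) (n : ℕ) : Set where
  constructor _,_
  field
    top   : coeff p n ≡ true
    above : VanishesFrom p (suc n)
open Deg

Deg-cong : ∀ {p q n} → p ≋ q → Deg p n → Deg q n
Deg-cong h d = trans (sym (at h _)) (top d) , λ i lt → trans (sym (at h i)) (above d i lt)

Deg-unique : ∀ {p m n} → Deg p m → Deg p n → m ≡ n
Deg-unique {p} {m} {n} d d′ with ℕ.<-cmp m n
... | tri≈ _ m≡n _ = m≡n
... | tri< m<n _ _ with () ← trans (sym (top d′)) (above d n m<n)
... | tri> _ _ n<m with () ← trans (sym (top d)) (above d′ m n<m)

Deg-+-lower : ∀ {p q n} → Deg p n → VanishesFrom q n → Deg (q +ₚ p) n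
Deg-+-lower {p} {q} {n} d low =
  trans (coeff-+ q p n) (cong₂ _xor_ (low n ℕ.≤-refl) (top d)) ,
  λ i lt → trans (coeff-+ q p i) (cong₂ _xor_ (low i (ℕ.<⇒≤ lt)) (above d i lt))

Deg-shift : ∀ {p n} → Deg p n → Deg (shift p) (suc n)
Deg-shift d = top d , λ { (suc i) (s≤s lt) → above d i lt }

Deg-* : ∀ {p q j k} → Deg p j → Deg q k → Deg (p *ₚ q) (j + k)
Deg-* {[]}    {q} {j} dp dq with () ← top dp
Deg-* {c ∷ p} {q} {zero} (refl , above₀) dq = Deg-cong (≋-sym (begin
  q +ₚ shift (p *ₚ q)  ≈⟨ +-cong (≋-refl {q}) (≋-trans (shift-cong (*-zeroˡ p q p≋[])) shift[]≋[]) ⟩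
  q +ₚ []              ≈⟨ +-identityʳ q ⟩
  q                    ∎)) dq
  where
  p≋[] : p ≋ []
  p≋[] = pw λ i → above₀ (suc i) (s≤s z≤n)
Deg-* {c ∷ p} {q} {suc j} {k} dp dq =
  Deg-+-lower (Deg-shift (Deg-* {p} (top dp , λ i lt → above dp (suc i) (s≤s lt)) dq))
    λ i lt → trans (coeff-scale c q i)
               (trans (cong (c ∧_) (above dq i (ℕ.<-≤-trans (s≤s (ℕ.m≤n+m k j)) lt))) (∧-zeroʳ c))

Deg-^ : ∀ {p k} n → Deg p k → Deg (p ^ₚ n) (n * k)
Deg-^ zero    d = refl , λ { (suc i) _ → refl }
Deg-^ (suc n) d = Deg-* d (Deg-^ n d)

Deg-1+ : ∀ {q n} → 1 ≤ n → Deg q n → Deg (oneₚ +ₚ q) n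
Deg-1+ (s≤s z≤n) d = Deg-+-lower d λ { (suc i) _ → refl }

Deg-snoc : ∀ l → Deg (l ++ (true ∷ [])) (length l)
Deg-snoc []      = refl , λ { (suc i) _ → refl }
Deg-snoc (c ∷ l) = top (Deg-snoc l) , λ { (suc i) (s≤s lt) → above (Deg-snoc l) i lt }

Deg-Qabc : ∀ a b c → 1 ≤ a → Deg (Qabc a b c) (a + b + 2 * c)
Deg-Qabc a@(suc _) b c (s≤s z≤n) = subst (Deg (Qabc a b c)) (arith a b c)
  (Deg-1+ (s≤s z≤n)
    (Deg-* (Deg-* (Deg-^ a Deg-x) (Deg-^ b Deg-x+1)) (Deg-^ c Deg-Q)))
  where
  arith : ∀ a b c → a * 1 + b * 1 + c * 2 ≡ a + b + 2 * c
  arith = solve-∀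
  Deg-x : Deg xₚ 1
  Deg-x = refl , λ { (suc (suc i)) _ → refl ; (suc zero) (s≤s ()) }
  Deg-x+1 : Deg x+1 1
  Deg-x+1 = refl , λ { (suc (suc i)) _ → refl ; (suc zero) (s≤s ()) }
  Deg-Q : Deg Qₚ 2
  Deg-Q = refl , λ { (suc (suc (suc i))) _ → refl ; (suc (suc zero)) (s≤s (s≤s ()))
                    ; (suc zero) (s≤s ()) }

length-+ : ∀ u v → length u ≡ length v → length (u +ₚ v) ≡ length u
length-+ []      []      e = refl
length-+ (c ∷ u) (d ∷ v) e = cong suc (length-+ u v (ℕ.suc-injective e))

snoc-+ : ∀ u v x y → length u ≡ length v →
  (u ++ (x ∷ [])) +ₚ (v ++ (y ∷ [])) ≡ (u +ₚ v) ++ ((x xor y) ∷ [])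
snoc-+ []      []      x y e = refl
snoc-+ (c ∷ u) (d ∷ v) x y e = cong ((c xor d) ∷_) (snoc-+ u v x y (ℕ.suc-injective e))

+-comm-≡ : ∀ u v → u +ₚ v ≡ v +ₚ u
+-comm-≡ []      []      = refl
+-comm-≡ []      (d ∷ v) = refl
+-comm-≡ (c ∷ u) []      = refl
+-comm-≡ (c ∷ u) (d ∷ v) = cong₂ _∷_ (xor-comm c d) (+-comm-≡ u v)

reverse-+ : ∀ u v → length u ≡ length v → reverse (u +ₚ v) ≡ reverse u +ₚ reverse v
reverse-+ []      []      e = refl
reverse-+ (c ∷ u) (d ∷ v) e =
  trans (List.unfold-reverse (c xor d) (u +ₚ v))
  (trans (cong (_++ ((c xor d) ∷ [])) (reverse-+ u v e′))
  (trans (sym (snoc-+ (reverse u) (reverse v) c d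
                 (trans (List.length-reverse u) (trans e′ (sym (List.length-reverse v))))))
  (sym (cong₂ _+ₚ_ (List.unfold-reverse c u) (List.unfold-reverse d v)))))
  where e′ = ℕ.suc-injective e

norm-snoc : ∀ l → norm (l ++ (true ∷ [])) ≡ l ++ (true ∷ [])
norm-snoc []      = refl
norm-snoc (c ∷ l) =
  trans (norm-∷ c (l ++ (true ∷ []))) (trans (cong (step c) (norm-snoc l)) (step-nonempty l))
  where
  step-nonempty : ∀ l → step c (l ++ (true ∷ [])) ≡ c ∷ (l ++ (true ∷ []))
  step-nonempty []      = refl
  step-nonempty (x ∷ l) = refl

++≋+shiftBy : ∀ l r → l ++ r ≋ l +ₚ shiftBy (length l) r
++≋+shiftBy []      r = ≋-refl
++≋+shiftBy (c ∷ l) r = ∷-cong (sym (xor-identityʳ c)) (++≋+shiftBy l r)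

trailing-zero : ∀ l → l ++ (false ∷ []) ≋ l
trailing-zero []      = shift[]≋[]
trailing-zero (c ∷ l) = ∷-cong refl (trailing-zero l)

-- The normal form of (x+1)^e, built by Pascal's rule; it is a palindrome.

Pal : ℕ → Poly
Pal zero    = true ∷ []
Pal (suc e) = (Pal e ++ (false ∷ [])) +ₚ (false ∷ Pal e)

Pal-snoc : ∀ e → Σ Poly λ l → (Pal e ≡ l ++ (true ∷ [])) × (length l ≡ e)
Pal-snoc zero    = [] , refl , refl
Pal-snoc (suc e) with Pal-snoc e
... | l , eq , len-l = (l ++ (true ∷ [])) +ₚ (false ∷ l) ,
        trans (cong (λ P → (P ++ (false ∷ [])) +ₚ (false ∷ P)) eq)
              (snoc-+ (l ++ (true ∷ [])) (false ∷ l) false true len) ,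
        trans (length-+ (l ++ (true ∷ [])) (false ∷ l) len) (trans len (cong suc len-l))
  where
  len : length (l ++ (true ∷ [])) ≡ suc (length l)
  len = trans (List.length-++ l) (ℕ.+-comm (length l) 1)

length-Pal : ∀ e → length (Pal e) ≡ suc e
length-Pal e with Pal-snoc e
... | l , eq , len-l =
  trans (cong length eq) (trans (List.length-++ l) (trans (ℕ.+-comm (length l) 1) (cong suc len-l)))

Pal-palindrome : ∀ e → reverse (Pal e) ≡ Pal e
Pal-palindrome zero    = refl
Pal-palindrome (suc e) =
  trans (reverse-+ (Pal e ++ (false ∷ [])) (false ∷ Pal e) len)
  (trans (cong₂ _+ₚ_ (trans (List.reverse-++ (Pal e) (false ∷ [])) (cong (false ∷_) (Pal-palindrome e)))
                     (trans (List.unfold-reverse false (Pal e)) (cong (_++ (false ∷ [])) (Pal-palindrome e))))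
  (+-comm-≡ (false ∷ Pal e) (Pal e ++ (false ∷ []))))
  where
  len : length (Pal e ++ (false ∷ [])) ≡ length (false ∷ Pal e)
  len = trans (List.length-++ (Pal e)) (ℕ.+-comm (length (Pal e)) 1)

[x+1]ⁿ≋Pal : ∀ e → x+1 ^ₚ e ≋ Pal e
[x+1]ⁿ≋Pal zero    = ≋-refl
[x+1]ⁿ≋Pal (suc e) = begin
  x+1 *ₚ x+1 ^ₚ e                          ≈⟨ +-cong (≋-refl {x+1 ^ₚ e}) (x*≋shift (x+1 ^ₚ e)) ⟩
  x+1 ^ₚ e +ₚ shift (x+1 ^ₚ e)             ≈⟨ +-cong ([x+1]ⁿ≋Pal e) (shift-cong ([x+1]ⁿ≋Pal e)) ⟩
  Pal e +ₚ shift (Pal e)                   ≈⟨ +-cong (trailing-zero (Pal e)) ≋-refl ⟨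
  Pal (suc e)                              ∎

-- Reciprocals.  For A with A(0) = 1 the reciprocal is an involution, so an
-- identity A* = B determines A as B*; and (1 + x^(d+1)(x+1)^e)* is
-- (x+1)^e + x^(e+d+1) because (x+1)^e is a palindrome.

reverse-zeros : ∀ n → reverse (replicate n false) ≡ replicate n false
reverse-zeros zero    = refl
reverse-zeros (suc n) =
  trans (List.unfold-reverse false (replicate n false))
        (trans (cong (_++ (false ∷ [])) (reverse-zeros n)) (zeros-snoc n))
  where
  zeros-snoc : ∀ n → replicate n false ++ (false ∷ []) ≡ false ∷ replicate n false
  zeros-snoc zero    = refl
  zeros-snoc (suc n) = cong (false ∷_) (zeros-snoc n)

norm-head : ∀ p → coeff p 0 ≡ true → Σ Poly λ t → norm p ≡ true ∷ t
norm-head p h with norm p | at (norm-≋ p) 0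
... | []    | e with () ← trans e h
... | c ∷ t | e = t , cong (_∷ t) (trans e h)

reciprocal-involutive : ∀ A → coeff A 0 ≡ true → reciprocal (reciprocal A) ≡ norm A
reciprocal-involutive A h with norm A | norm-head A h
... | .(true ∷ t) | t , refl =
  trans (cong (λ l → reverse (norm l)) (List.unfold-reverse true t))
  (trans (cong reverse (norm-snoc (reverse t)))
  (trans (cong reverse (sym (List.unfold-reverse true t))) (List.reverse-involutive (true ∷ t))))

reciprocal-cong : ∀ {B B′} → B ≋ B′ → reciprocal B ≡ reciprocal B′
reciprocal-cong {B} {B′} h = cong reverse (≋⇒≈ₚ B B′ h)

reciprocal-1+shift : ∀ d l →
  reciprocal (true ∷ shiftBy d (l ++ (true ∷ []))) ≡ reverse (l ++ (true ∷ [])) ++ shiftBy d (true ∷ [])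
reciprocal-1+shift d l =
  trans (cong reverse (trans (cong norm as-snoc) (trans (norm-snoc (true ∷ zeros ++ l)) (sym as-snoc))))
  (trans (List.unfold-reverse true (zeros ++ P))
  (trans (cong (_++ (true ∷ [])) (trans (List.reverse-++ zeros P) (cong (reverse P ++_) (reverse-zeros d))))
  (List.++-assoc (reverse P) zeros (true ∷ []))))
  where
  zeros = replicate d false
  P = l ++ (true ∷ [])
  as-snoc : true ∷ zeros ++ P ≡ (true ∷ zeros ++ l) ++ (true ∷ [])
  as-snoc = cong (true ∷_) (sym (List.++-assoc zeros l (true ∷ [])))

reciprocal-equation : ∀ A d e → coeff A 0 ≡ true →
  reciprocal A ≈ₚ oneₚ +ₚ (xₚ ^ₚ suc d) *ₚ (x+1 ^ₚ e) →
  (A ≋ x+1 ^ₚ e +ₚ xₚ ^ₚ (suc e + d)) × Deg A (suc e + d)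
reciprocal-equation A d e h₀ A*≈B with Pal-snoc e
... | l , Pal≡ , _ = A≋ , subst (Deg A) length-L (Deg-cong (≋-sym A≋L) Deg-L)
  where
  B = oneₚ +ₚ (xₚ ^ₚ suc d) *ₚ (x+1 ^ₚ e)
  L = Pal e ++ shiftBy d (true ∷ [])
  B≋ : B ≋ true ∷ shiftBy d (Pal e)
  B≋ = +-cong (≋-refl {oneₚ}) (≋-trans (xⁿ*≋shiftBy (suc d) _) (shiftBy-cong (suc d) ([x+1]ⁿ≋Pal e)))
  normA : norm A ≡ L
  normA =
    trans (sym (reciprocal-involutive A h₀))
    (trans (cong reverse A*≈B)
    (trans (reciprocal-cong B≋)
    (trans (cong (λ P → reciprocal (true ∷ shiftBy d P)) Pal≡)
    (trans (reciprocal-1+shift d l)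
    (cong (_++ shiftBy d (true ∷ [])) (trans (cong reverse (sym Pal≡)) (Pal-palindrome e)))))))
  A≋L : A ≋ L
  A≋L = ≋-trans (≋-sym (norm-≋ A)) (≡⇒≋ normA)
  A≋ : A ≋ x+1 ^ₚ e +ₚ xₚ ^ₚ (suc e + d)
  A≋ = begin
    A                                                    ≈⟨ A≋L ⟩
    L                                                    ≈⟨ ++≋+shiftBy (Pal e) (shiftBy d (true ∷ [])) ⟩
    Pal e +ₚ shiftBy (length (Pal e)) (shiftBy d oneₚ)
      ≡⟨ cong (λ n → Pal e +ₚ shiftBy n (shiftBy d oneₚ)) (length-Pal e) ⟩
    Pal e +ₚ shiftBy (suc e) (shiftBy d oneₚ)            ≡⟨ cong (Pal e +ₚ_) (shiftBy-+ (suc e) d oneₚ) ⟩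
    Pal e +ₚ shiftBy (suc e + d) oneₚ                    ≈⟨ +-cong ([x+1]ⁿ≋Pal e) (xⁿ≋shiftBy (suc e + d)) ⟨
    x+1 ^ₚ e +ₚ xₚ ^ₚ (suc e + d)                        ∎
  Deg-L : Deg L (length (Pal e ++ replicate d false))
  Deg-L = subst (λ P → Deg P (length (Pal e ++ replicate d false)))
                (List.++-assoc (Pal e) (replicate d false) (true ∷ []))
                (Deg-snoc (Pal e ++ replicate d false))
  length-L : length (Pal e ++ replicate d false) ≡ suc e + d
  length-L = trans (List.length-++ (Pal e)) (cong₂ _+_ (length-Pal e) (List.length-replicate d))

odd-power-of-two : ∀ k → ¬ (2 ∣ 2 ^ k) → 2 ^ k ≡ 1
odd-power-of-two zero    _   = refl
odd-power-of-two (suc k) odd = ⊥-elim (odd (divides (2 ^ k) (ℕ.*-comm 2 (2 ^ k))))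

2∤3 : ¬ (2 ∣ 3)
2∤3 (divides (suc (suc q)) ())

3≢2^j : ∀ j → ¬ (3 ≡ 2 ^ j)
3≢2^j j 3≡2^j with () ← trans 3≡2^j (odd-power-of-two j (subst (λ n → ¬ (2 ∣ n)) 3≡2^j 2∤3))

odd-multiple : ∀ P s → P * suc (s + s) ≡ P + 2 * (P * s)
odd-multiple = solve-∀

G : ℕ → ℕ → ℕ → Poly
G a b c = (xₚ ^ₚ a) *ₚ (x+1 ^ₚ b) *ₚ (Qₚ ^ₚ c)

Val-G : ∀ a b c → Val (G a b c) a
Val-G a b c = subst (Val (G a b c)) (trans (ℕ.+-identityʳ _) (ℕ.+-identityʳ a))
  (Val-* (Val-* (Val-xⁿ a) (Val-unit (x+1 ^ₚ b) (const-^ x+1 b refl)))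
         (Val-unit (Qₚ ^ₚ c) (const-^ Qₚ c refl)))

Val-σG : ∀ a b c → Val (σ (G a b c)) b
Val-σG a b c = Val-cong (≋-sym σG≋) (subst (Val _) (ℕ.+-identityʳ b)
  (Val-* (Val-* (Val-unit (x+1 ^ₚ a) (const-^ x+1 a refl)) (Val-xⁿ b))
         (Val-unit (Qₚ ^ₚ c) (const-^ Qₚ c refl))))
  where
  σG≋ : σ (G a b c) ≋ (x+1 ^ₚ a) *ₚ (xₚ ^ₚ b) *ₚ (Qₚ ^ₚ c)
  σG≋ = ≋-trans (σ-* ((xₚ ^ₚ a) *ₚ (x+1 ^ₚ b)) (Qₚ ^ₚ c))
          (*-cong (≋-trans (σ-* (xₚ ^ₚ a) (x+1 ^ₚ b)) (*-cong (σ-xⁿ a) (σ-[x+1]ⁿ b))) (σ-Qⁿ c))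

const-Qabc : ∀ a b c → 1 ≤ a → coeff (Qabc a b c) 0 ≡ true
const-Qabc a b c a≥1 with Val-G a b c
... | U , _ , G≋ =
  trans (coeff-+ oneₚ (G a b c) 0) (cong (true xor_) (trans (at G≋ 0) (coeff-shiftBy< a U 0 a≥1)))

-- Step 1: (Q^{abc})* = 1 + x^d (x+1)^e forces Q^{abc} = (x+1)^e + x^{a+b+2c},
-- comparing degrees gives a + b + 2c = e + d.
Qabc-shape : ∀ a b c d e → 1 ≤ a → 1 ≤ d →
  reciprocal (Qabc a b c) ≈ₚ oneₚ +ₚ (xₚ ^ₚ d) *ₚ (x+1 ^ₚ e) →
  (Qabc a b c ≋ x+1 ^ₚ e +ₚ xₚ ^ₚ (a + b + 2 * c)) × (a + b + 2 * c ≡ e + d)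
Qabc-shape a b c (suc d) e a≥1 _ H with reciprocal-equation (Qabc a b c) d e (const-Qabc a b c a≥1) H
... | Q≋ , degQ =
  subst (λ n → Qabc a b c ≋ x+1 ^ₚ e +ₚ xₚ ^ₚ n) (sym M≡) Q≋ , trans M≡ (sym (ℕ.+-suc e d))
  where
  M≡ : a + b + 2 * c ≡ suc e + d
  M≡ = Deg-unique (Deg-Qabc a b c a≥1) degQ

-- Step 2: comparing valuations at 0 gives a = 2^k where 2^k ∥ e; a is odd,
-- so a = 1.
a≡1 : ∀ a b c e → 1 ≤ b → 1 ≤ e → ¬ (2 ∣ a) →
  Qabc a b c ≋ x+1 ^ₚ e +ₚ xₚ ^ₚ (a + b + 2 * c) → a ≡ 1
a≡1 a b c e b≥1 e≥1 a-odd Q≋ with two-adic e e≥1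
... | k , s , e≡ = trans a≡2^k (odd-power-of-two k (subst (λ n → ¬ (2 ∣ n)) a≡2^k a-odd))
  where
  M = a + b + 2 * c
  a<M : a < M
  a<M = ℕ.<-≤-trans (ℕ.m<m+n a b≥1) (ℕ.m≤m+n (a + b) (2 * c))
  a≡2^k : a ≡ 2 ^ k
  -- 1 + (x+1)^e = G + x^M, and v(G) = a < M
  a≡2^k = Val-unique (Val-cong (≋-sym (+-swap oneₚ (G a b c) (x+1 ^ₚ e) (xₚ ^ₚ M) Q≋))
                               (Val-+ (Val-G a b c) (Val-xⁿ M) a<M))
                     (Val-1+power x+1 refl refl e k s e≡)

-- Step 3: after x ↦ x + 1 the same comparison at 0 gives e = 1, because
-- a + b + 2c is odd and b ≥ 2.
e≡1 : ∀ a b c e t → 1 < b → a + b + 2 * c ≡ suc (t + t) →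
  Qabc a b c ≋ x+1 ^ₚ e +ₚ xₚ ^ₚ (a + b + 2 * c) → e ≡ 1
e≡1 a b c e t b>1 M-odd Q≋ = Val-unique (Val-xⁿ e) (Val-cong (≋-sym xᵉ≋) V)
  where
  M = a + b + 2 * c
  σQ≋ : oneₚ +ₚ σ (G a b c) ≋ xₚ ^ₚ e +ₚ x+1 ^ₚ M
  σQ≋ = begin
    oneₚ +ₚ σ (G a b c)                ≈⟨ +-cong σ-one (≋-refl {σ (G a b c)}) ⟨
    σ oneₚ +ₚ σ (G a b c)              ≈⟨ σ-+ oneₚ (G a b c) ⟨
    σ (Qabc a b c)                     ≈⟨ σ-cong Q≋ ⟩
    σ (x+1 ^ₚ e +ₚ xₚ ^ₚ M)            ≈⟨ σ-+ (x+1 ^ₚ e) (xₚ ^ₚ M) ⟩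
    σ (x+1 ^ₚ e) +ₚ σ (xₚ ^ₚ M)        ≈⟨ +-cong (σ-[x+1]ⁿ e) (σ-xⁿ M) ⟩
    xₚ ^ₚ e +ₚ x+1 ^ₚ M                ∎
  xᵉ≋ : xₚ ^ₚ e ≋ (oneₚ +ₚ x+1 ^ₚ M) +ₚ σ (G a b c)
  xᵉ≋ = +-isolate oneₚ (σ (G a b c)) (xₚ ^ₚ e) (x+1 ^ₚ M) σQ≋
  V : Val ((oneₚ +ₚ x+1 ^ₚ M) +ₚ σ (G a b c)) 1
  V = Val-+ (Val-1+power x+1 refl refl M 0 t (trans M-odd (sym (ℕ.*-identityˡ _)))) (Val-σG a b c) b>1

-- Step 4: with a = e = 1, cancelling the common factor x leaves
-- (x+1)^b Q^c = 1 + x^{b+2c}.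
reduced-equation : ∀ b c → Qabc 1 b c ≋ x+1 ^ₚ 1 +ₚ xₚ ^ₚ (1 + b + 2 * c) →
  (x+1 ^ₚ b) *ₚ (Qₚ ^ₚ c) ≋ oneₚ +ₚ xₚ ^ₚ (b + 2 * c)
reduced-equation b c Q≋ = tail-≋ (begin
  true ∷ F                                    ≈⟨ +-cong (≋-refl {oneₚ}) G≋xF ⟨
  Qabc 1 b c                                  ≈⟨ Q≋ ⟩
  x+1 ^ₚ 1 +ₚ xₚ ^ₚ (1 + b + 2 * c)           ≈⟨ +-cong (*-identityʳ x+1) (x*≋shift (xₚ ^ₚ (b + 2 * c))) ⟩
  true ∷ (oneₚ +ₚ xₚ ^ₚ (b + 2 * c))          ∎)
  where
  F = (x+1 ^ₚ b) *ₚ (Qₚ ^ₚ c)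
  G≋xF : G 1 b c ≋ shift F
  G≋xF = ≋-trans (*-congˡ (Qₚ ^ₚ c) (*-congˡ (x+1 ^ₚ b) (*-identityʳ xₚ)))
                 (≋-trans (*-assoc xₚ (x+1 ^ₚ b) (Qₚ ^ₚ c)) (x*≋shift F))

-- Step 5: after x ↦ x + 1, x^b Q^c = 1 + (x+1)^{b+2c}; comparing
-- valuations, b is the 2-part 2^m of b + 2c, hence c = 2^m·s, and m ≥ 1
-- since b is even.
b≡2^m : ∀ b c → 1 ≤ b → 2 ∣ b → (x+1 ^ₚ b) *ₚ (Qₚ ^ₚ c) ≋ oneₚ +ₚ xₚ ^ₚ (b + 2 * c) →
  Σ ℕ λ m → Σ ℕ λ s → (1 ≤ m) × (b ≡ 2 ^ m) × (c ≡ 2 ^ m * s)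
b≡2^m b c b≥1 b-even E with two-adic (b + 2 * c) (ℕ.≤-trans b≥1 (ℕ.m≤m+n b (2 * c)))
... | k , s , N≡ = k , s , positive k b≡2^k , b≡2^k , c≡
  where
  σE : (xₚ ^ₚ b) *ₚ (Qₚ ^ₚ c) ≋ oneₚ +ₚ x+1 ^ₚ (b + 2 * c)
  σE = begin
    (xₚ ^ₚ b) *ₚ (Qₚ ^ₚ c)               ≈⟨ *-cong (σ-[x+1]ⁿ b) (σ-Qⁿ c) ⟨
    σ (x+1 ^ₚ b) *ₚ σ (Qₚ ^ₚ c)          ≈⟨ σ-* (x+1 ^ₚ b) (Qₚ ^ₚ c) ⟨
    σ ((x+1 ^ₚ b) *ₚ (Qₚ ^ₚ c))          ≈⟨ σ-cong E ⟩
    σ (oneₚ +ₚ xₚ ^ₚ (b + 2 * c))        ≈⟨ σ-+ oneₚ (xₚ ^ₚ (b + 2 * c)) ⟩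
    σ oneₚ +ₚ σ (xₚ ^ₚ (b + 2 * c))      ≈⟨ +-cong σ-one (σ-xⁿ (b + 2 * c)) ⟩
    oneₚ +ₚ x+1 ^ₚ (b + 2 * c)           ∎
  b≡2^k : b ≡ 2 ^ k
  b≡2^k = Val-unique (Val-cong σE (subst (Val _) (ℕ.+-identityʳ b)
                        (Val-* (Val-xⁿ b) (Val-unit (Qₚ ^ₚ c) (const-^ Qₚ c refl)))))
                     (Val-1+power x+1 refl refl (b + 2 * c) k s N≡)
  positive : ∀ k → b ≡ 2 ^ k → 1 ≤ k
  positive zero    b≡1 with () ← ∣1⇒≡1 (subst (2 ∣_) b≡1 b-even)
  positive (suc k) _   = s≤s z≤n
  c≡ : c ≡ 2 ^ k * s
  c≡ = ℕ.*-cancelˡ-≡ c (2 ^ k * s) 2 (ℕ.+-cancelˡ-≡ (2 ^ k) _ _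
         (trans (cong (_+ 2 * c) (sym b≡2^k)) (trans N≡ (odd-multiple (2 ^ k) s))))

-- Step 6: (x+1) Q^s = 1 + x^{2s+1} forces s = 1.  For s = t + 1 ≥ 2,
-- (x+1)Q = 1 + x³ turns it into 1 + Q^t = x³ Q^t + x^{2s+1}, so 1 + Q^t
-- would have valuation 3, which is not a power of 2.
s≡1 : ∀ s → 1 ≤ s → x+1 ^ₚ 1 *ₚ Qₚ ^ₚ s ≋ oneₚ +ₚ xₚ ^ₚ suc (s + s) → s ≡ 1
s≡1 (suc zero)    _ _ = refl
s≡1 (suc (suc r)) _ E with two-adic (suc r) (s≤s z≤n)
... | j , s′ , t≡ = ⊥-elim (3≢2^j j 3≡2^j)
  where
  t = suc r
  x³ = xₚ ^ₚ 3
  [x+1]Q≋1+x³ : x+1 *ₚ Qₚ ≋ oneₚ +ₚ x³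
  [x+1]Q≋1+x³ = ≈ₚ⇒≋ refl
  lhs : x+1 ^ₚ 1 *ₚ Qₚ ^ₚ suc t ≋ Qₚ ^ₚ t +ₚ x³ *ₚ Qₚ ^ₚ t
  lhs = begin
    x+1 ^ₚ 1 *ₚ (Qₚ *ₚ Qₚ ^ₚ t)          ≈⟨ *-congˡ (Qₚ *ₚ Qₚ ^ₚ t) (*-identityʳ x+1) ⟩
    x+1 *ₚ (Qₚ *ₚ Qₚ ^ₚ t)               ≈⟨ *-assoc x+1 Qₚ (Qₚ ^ₚ t) ⟨
    (x+1 *ₚ Qₚ) *ₚ Qₚ ^ₚ t               ≈⟨ *-congˡ (Qₚ ^ₚ t) [x+1]Q≋1+x³ ⟩
    (oneₚ +ₚ x³) *ₚ Qₚ ^ₚ t              ≈⟨ distribʳ oneₚ x³ (Qₚ ^ₚ t) ⟩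
    oneₚ *ₚ Qₚ ^ₚ t +ₚ x³ *ₚ Qₚ ^ₚ t     ≈⟨ +-cong (*-identityˡ (Qₚ ^ₚ t)) (≋-refl {x³ *ₚ Qₚ ^ₚ t}) ⟩
    Qₚ ^ₚ t +ₚ x³ *ₚ Qₚ ^ₚ t             ∎
  rhs : oneₚ +ₚ xₚ ^ₚ suc (suc t + suc t) ≋ oneₚ +ₚ x³ *ₚ xₚ ^ₚ (t + t)
  rhs = +-cong (≋-refl {oneₚ}) (≋-trans (≡⇒≋ (cong (xₚ ^ₚ_) (arith t))) (^-+ xₚ 3 (t + t)))
    where
    arith : ∀ t → suc (suc t + suc t) ≡ 3 + (t + t)
    arith = solve-∀
  1+Qᵗ≋ : oneₚ +ₚ Qₚ ^ₚ t ≋ x³ *ₚ Qₚ ^ₚ t +ₚ x³ *ₚ xₚ ^ₚ (t + t)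
  1+Qᵗ≋ = ≋-trans (+-swap oneₚ (x³ *ₚ xₚ ^ₚ (t + t)) (Qₚ ^ₚ t) (x³ *ₚ Qₚ ^ₚ t)
                     (≋-trans (≋-sym rhs) (≋-trans (≋-sym E) lhs)))
                  (+-comm (x³ *ₚ xₚ ^ₚ (t + t)) (x³ *ₚ Qₚ ^ₚ t))
  3≡2^j : 3 ≡ 2 ^ j
  3≡2^j = Val-unique
    (Val-cong (≋-sym 1+Qᵗ≋) (Val-+ (Val-* (Val-xⁿ 3) (Val-unit (Qₚ ^ₚ t) (const-^ Qₚ t refl)))
                                    (Val-* (Val-xⁿ 3) (Val-xⁿ (t + t)))
                                    (s≤s (s≤s (s≤s (s≤s z≤n))))))
    (Val-1+power Qₚ refl refl t j s′ t≡)

-- Steps 5 and 6 combined, with the 2^m-th root taken in between: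
-- b = c = 2^m, and then d = b + 2c = 3·2^m.
powers-of-two : ∀ b c d → 1 ≤ b → 1 ≤ c → 2 ∣ b → b + 2 * c ≡ d →
  (x+1 ^ₚ b) *ₚ (Qₚ ^ₚ c) ≋ oneₚ +ₚ xₚ ^ₚ (b + 2 * c) →
  ∃[ m ] (1 ≤ m × b ≡ 2 ^ m × c ≡ 2 ^ m × d ≡ 3 * 2 ^ m)
powers-of-two b c d b≥1 c≥1 b-even refl E with b≡2^m b c b≥1 b-even E
... | m , s , m≥1 , refl , refl = m , m≥1 , refl , c≡2^m , d≡3·2^m
  where
  P = 2 ^ m
  s≥1 : ∀ s → 1 ≤ P * s → 1 ≤ s
  s≥1 zero    c≥1 with () ← subst (1 ≤_) (ℕ.*-zeroʳ P) c≥1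
  s≥1 (suc s) _   = s≤s z≤n
  E′ : x+1 ^ₚ (P * 1) *ₚ Qₚ ^ₚ (P * s) ≋ oneₚ +ₚ xₚ ^ₚ (P * suc (s + s))
  E′ = subst₂ (λ u v → x+1 ^ₚ u *ₚ Qₚ ^ₚ (P * s) ≋ oneₚ +ₚ xₚ ^ₚ v)
              (sym (ℕ.*-identityʳ P)) (sym (odd-multiple P s)) E
  c≡2^m : P * s ≡ P
  c≡2^m = trans (cong (P *_) (s≡1 s (s≥1 s c≥1) (frobenius-root m x+1 Qₚ xₚ 1 s (suc (s + s)) E′)))
                (ℕ.*-identityʳ P)
  d≡3·2^m : P + 2 * (P * s) ≡ 3 * P
  d≡3·2^m = trans (cong (λ c → P + 2 * c) c≡2^m) (triple P)
    where
    triple : ∀ P → P + 2 * P ≡ 3 * P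
    triple = solve-∀

even>1 : ∀ {b} q → b ≡ q * 2 → 1 ≤ b → 1 < b
even>1 zero    refl ()
even>1 (suc q) refl _ = s≤s (s≤s z≤n)

1+even+even : ∀ {b} q c → b ≡ q * 2 → 1 + b + 2 * c ≡ suc ((q + c) + (q + c))
1+even+even q c refl = arith q c
  where
  arith : ∀ q c → 1 + q * 2 + 2 * c ≡ suc ((q + c) + (q + c))
  arith = solve-∀

-- The theorem.
lemma3p14 : (a b c d e : ℕ) → 1 ≤ a → 1 ≤ b → 1 ≤ c → 1 ≤ d → 1 ≤ e →
    Irreducible (Qabc a b c) →
    reciprocal (Qabc a b c) ≈ₚ oneₚ +ₚ (xₚ ^ₚ d) *ₚ (x+1 ^ₚ e) →
    ¬ (2 ∣ a) → 2 ∣ b →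
    a ≡ 1 × e ≡ 1 × (∃[ m ] (1 ≤ m × b ≡ 2 ^ m × c ≡ 2 ^ m × d ≡ 3 * 2 ^ m))
lemma3p14 a b c d e a≥1 b≥1 c≥1 d≥1 e≥1 _ Q*≈ a-odd b-even@(divides q b≡q*2)
  with Qabc-shape a b c d e a≥1 d≥1 Q*≈
... | Q≋ , M≡e+d with a≡1 a b c e b≥1 e≥1 a-odd Q≋
... | refl with e≡1 1 b c e (q + c) (even>1 q b≡q*2 b≥1) (1+even+even q c b≡q*2) Q≋
... | refl = refl , refl ,
  powers-of-two b c d b≥1 c≥1 b-even (ℕ.suc-injective M≡e+d) (reduced-equation b c Q≋)
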